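{- Let $\delta,\tau\in\mathbb{N}$ and $\rho\in\mathbb{N}\cup\{0\}$. Let $G$ be a graph with no minor isomorphic to $K_{\tau+1}$, and let $(T,u)$ be a $(\Delta,\rho)$-regular rooted tree, for some $\Delta\in\mathbb{N}$ with $\Delta\ge\tau^{\delta-1}$, where $T$ is a (not necessarily induced) subgraph of $G$. Then some $(\delta,\rho)$-regular rooted subtree $(T',u)$ of $(T,u)$ is branch-induced in $G$.
   Context: Graphs are finite and simple; $\mathbb{N}$ is the positive integers. A rooted tree is a pair $(T,u)$ with $T$ a tree and $u\in V(T)$. An ancestor of $v$ in $(T,u)$ is any vertex on the $u$–$v$ path of $T$ (including $u$ and $v$); a child of $v$ is a neighbor of $v$ in $T$ whose $u$-path passes through $v$ (i.e., $v$ is its neighbor on the path to $u$). $N^\rho_T(u)$ is the set of vertices at distance exactly $\rho$ from $u$ in $T$. A rooted subtree of $(T,u)$ is a rooted tree $(T',u')$ with $T'$ an induced subgraph of $T$ such that for every $v\in V(T')$, every child of $v$ in $(T',u')$ is a child of $v$ in $(T,u)$. $(T,u)$ is $(\delta,\rho)$-regular if every vertex is at distance at most $\rho$ from $u$ and every vertex not in $N^\rho_T(u)$ has exactly $\delta$ children. If $T$ is a subgraph of $G$, $(T,u)$ is branch-induced in $G$ if for every edge $xy\in E(G)\setminus E(T)$ with $x,y\in V(T)$, one of $x,y$ is an ancestor of the other in $(T,u)$. -}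

module Defs where

open import Data.Nat using (ℕ; zero; suc; _≤_; _^_; _∸_)
open import Data.Fin using (Fin)
open import Data.Bool using (Bool; true; false; _∧_)
open import Data.Maybe using (just)
open import Data.List using (List; []; _∷_; length; head; last)
open import Data.List.Relation.Unary.All using (All)
open import Data.List.Relation.Unary.Linked using (Linked)
open import Data.List.Relation.Unary.Unique.Propositional using (Unique)
open import Data.List.Membership.Propositional using (_∈_)
open import Data.Product using (Σ; ∃; _×_)
open import Data.Sum using (_⊎_)
open import Relation.Nullary using (¬_)
open import Relation.Binary.PropositionalEquality using (_≡_; _≢_)

record Graph : Set where
  field
    n      : ℕ
    adj    : Fin n → Fin n → Bool
    sym    : ∀ x y → adj x y ≡ adj y x
    irrefl : ∀ x → adj x x ≡ false
open Graph public

record SG (n : ℕ) : Set where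
  field
    V : Fin n → Bool
    E : Fin n → Fin n → Bool
open SG public

module _ {n : ℕ} (H : SG n) where

  Walk : Fin n → Fin n → List (Fin n) → Set
  Walk x y p = head p ≡ just x × last p ≡ just y
             × All (λ v → V H v ≡ true) p × Linked (λ a b → E H a b ≡ true) p

  Path : Fin n → Fin n → List (Fin n) → Set
  Path x y p = Walk x y p × Unique p

  Connected : Set
  Connected = ∀ x y → V H x ≡ true → V H y ≡ true → ∃ λ p → Walk x y p

  Cycle : List (Fin n) → Set
  Cycle p = 3 ≤ length p × All (λ v → V H v ≡ true) p
          × Linked (λ a b → E H a b ≡ true) p × Unique p
          × ∃ λ x → ∃ λ y → head p ≡ just x × last p ≡ just y × E H y x ≡ true

  Acyclic : Set
  Acyclic = ∀ p → ¬ Cycle p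

  IsTree : Set
  IsTree = (∃ λ v → V H v ≡ true) × Connected × Acyclic

  -- dist_H(x,y) = d  (a walk with d edges exists and none is shorter)
  DistEq : Fin n → Fin n → ℕ → Set
  DistEq x y d = (∃ λ p → Walk x y p × length p ≡ suc d)
               × (∀ p → Walk x y p → suc d ≤ length p)

  Ancestor : Fin n → Fin n → Fin n → Set
  Ancestor u a v = ∃ λ p → Path u v p × a ∈ p

  Child : Fin n → Fin n → Fin n → Set
  Child u v w = E H v w ≡ true × Ancestor u v w

  HasChildren : Fin n → Fin n → ℕ → Set
  HasChildren u v k = ∃ λ cs → length cs ≡ k × Unique cs
                    × (∀ w → (w ∈ cs → Child u v w) × (Child u v w → w ∈ cs))

  Regular : Fin n → ℕ → ℕ → Set
  Regular u δ ρ =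
      (∀ v → V H v ≡ true → ∃ λ d → d ≤ ρ × DistEq u v d)
    × (∀ v → V H v ≡ true → ¬ DistEq u v ρ → HasChildren u v δ)

  IsRootedTree : Fin n → Set
  IsRootedTree u = IsTree × V H u ≡ true

IsSubgraph : (G : Graph) → SG (n G) → Set
IsSubgraph G T =
    (∀ x y → E T x y ≡ E T y x)
  × (∀ x y → E T x y ≡ true → V T x ≡ true × V T y ≡ true × adj G x y ≡ true)

RootedSubtree : {n : ℕ} → SG n → Fin n → SG n → Fin n → Set
RootedSubtree T u T' u' =
    (∀ v → V T' v ≡ true → V T v ≡ true)
  × (∀ x y → E T' x y ≡ (V T' x ∧ V T' y ∧ E T x y))
  × IsRootedTree T' u'
  × (∀ v w → V T' v ≡ true → Child T' u' v w → Child T u v w)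

BranchInduced : (G : Graph) → SG (n G) → Fin (n G) → Set
BranchInduced G T u =
  ∀ x y → adj G x y ≡ true → E T x y ≡ false → V T x ≡ true → V T y ≡ true
        → Ancestor T u x y ⊎ Ancestor T u y x

Induced : (G : Graph) → (Fin (n G) → Bool) → SG (n G)
Induced G B = record { V = B ; E = λ x y → B x ∧ B y ∧ adj G x y }

HasCliqueMinor : Graph → ℕ → Set
HasCliqueMinor G k =
  Σ (Fin k → Fin (n G) → Bool) λ B →
      (∀ i → ∃ λ x → B i x ≡ true)
    × (∀ i → Connected (Induced G (B i)))
    × (∀ i j → i ≢ j → ∀ x → B i x ≡ true → B j x ≡ false)
    × (∀ i j → i ≢ j → ∃ λ x → ∃ λ y → B i x ≡ true × B j y ≡ true × adj G x y ≡ true)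

{-# OPTIONS --safe #-}
-- Prune T from the leaves up. Suppose every child c of a vertex v already carries a (δ, h)-regular
-- branch-induced subtree S c, and call two children adjacent when an edge of G joins their subtrees.
-- Then τ pairwise adjacent children together with {v} are the branch sets of a K_{τ+1} minor: the
-- subtrees are connected and disjoint, and v is joined to each child.
-- Hence by the Ramsey bound R(τ, δ) ≤ τ^(δ-1) ≤ Δ some δ children are pairwise non-adjacent; keeping
-- exactly their subtrees below v leaves no edge of G between different branches.
module Submission where

open import Defs hiding (sym)
open import Data.Nat using (ℕ; zero; suc; _+_; _*_; _≤_; _<_; _^_; _∸_; z≤n; s≤s; _≤?_; _≟_)
open import Data.Nat.Properties
open import Data.Fin using (Fin; zero; suc) renaming (_≟_ to _≟ᶠ_)
open import Data.Fin.Properties using (any?)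
open import Data.Bool using (Bool; true; false; _∧_; _∨_)
open import Data.Bool.Properties using (T-≡; ¬-not) renaming (_≟_ to _≟ᵇ_)
open import Data.Maybe using (just)
open import Data.Maybe.Properties using (just-injective)
open import Data.List using (List; []; _∷_; _++_; [_]; _∷ʳ_; length; head; last; reverse; filter)
open import Data.Bool.ListAction using (any)
open import Data.List.Properties using (∷-injectiveʳ; ++-assoc; length-++; length-reverse; unfold-reverse; reverse-++)
open import Data.List.Relation.Unary.All as All using (All; []; _∷_)
import Data.List.Relation.Unary.All.Properties as All
open import Data.List.Relation.Unary.Any using (here; there)
import Data.List.Relation.Unary.Any.Properties as Any
open import Data.List.Relation.Unary.AllPairs as AllPairs using (AllPairs; []; _∷_)
open import Data.List.Relation.Unary.Linked as Linked using (Linked; []; [-]; _∷_)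
open import Data.List.Relation.Unary.Linked.Properties using (Linked⇒AllPairs)
open import Data.List.Relation.Unary.Unique.Propositional using (Unique)
import Data.List.Relation.Unary.Unique.Propositional.Properties as Unique
import Data.List.Relation.Unary.First as First
open import Data.List.Relation.Unary.First.Properties using (toView)
open import Data.List.Relation.Binary.Disjoint.Propositional using (Disjoint)
open import Data.List.Membership.Propositional using (_∈_; _∉_; find; lose)
open import Data.List.Membership.Propositional.Properties using (∈-∃++; ∈-++⁺ˡ; ∈-++⁺ʳ; ∈-filter⁻)
open import Data.Product using (Σ; ∃; ∃₂; _×_; _,_; proj₁; proj₂)
open import Data.Sum as Sum using (_⊎_; inj₁; inj₂)
open import Data.Empty using (⊥; ⊥-elim)
open import Relation.Nullary using (¬_; Dec; yes; no; does; toSum; _×-dec_)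
open import Relation.Unary using (Decidable)
open import Relation.Unary.Properties using (∁?)
open import Function using (_∘_; Equivalence)
open import Relation.Binary.PropositionalEquality using (_≡_; _≢_; refl; sym; trans; cong; subst; module ≡-Reasoning)

module _ {A : Set} where

  head-∈ : ∀ {xs : List A} {x} → head xs ≡ just x → x ∈ xs
  head-∈ {_ ∷ _} refl = here refl

  last-∈ : ∀ {xs : List A} {x} → last xs ≡ just x → x ∈ xs
  last-∈ {_ ∷ []}    refl = here refl
  last-∈ {_ ∷ y ∷ xs} e   = there (last-∈ {y ∷ xs} e)

  last-∈-tail : ∀ {x y z} (xs : List A) → head xs ≡ just z → last (x ∷ xs) ≡ just y → y ∈ xs
  last-∈-tail (_ ∷ _) refl l = last-∈ l

  head-++ : ∀ {x} (xs : List A) {ys} → head xs ≡ just x → head (xs ++ ys) ≡ just x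
  head-++ (_ ∷ _) refl = refl

  head-++-∷ : ∀ (xs : List A) {y} ys zs → head (xs ++ y ∷ ys) ≡ head (xs ++ y ∷ zs)
  head-++-∷ []      _ _ = refl
  head-++-∷ (_ ∷ _) _ _ = refl

  last-++-∷ : ∀ (xs : List A) y ys → last (xs ++ y ∷ ys) ≡ last (y ∷ ys)
  last-++-∷ []           _ _  = refl
  last-++-∷ (_ ∷ [])     _ _  = refl
  last-++-∷ (_ ∷ x ∷ xs) y ys = last-++-∷ (x ∷ xs) y ys

  last-∷ʳ : ∀ (xs : List A) y → last (xs ∷ʳ y) ≡ just y
  last-∷ʳ xs y = last-++-∷ xs y []

  Linked-++⁻ˡ : ∀ {R : A → A → Set} xs {ys} → Linked R (xs ++ ys) → Linked R xs
  Linked-++⁻ˡ []           _        = []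
  Linked-++⁻ˡ (_ ∷ [])     _        = [-]
  Linked-++⁻ˡ (_ ∷ y ∷ xs) (r ∷ rs) = r ∷ Linked-++⁻ˡ (y ∷ xs) rs

  Linked-++⁻ʳ : ∀ {R : A → A → Set} xs {ys} → Linked R (xs ++ ys) → Linked R ys
  Linked-++⁻ʳ []       rs = rs
  Linked-++⁻ʳ (_ ∷ xs) rs = Linked-++⁻ʳ xs (Linked.tail rs)

  Linked-∷ʳ : ∀ {R : A → A → Set} {xs x y} → Linked R xs → last xs ≡ just x → R x y → Linked R (xs ∷ʳ y)
  Linked-∷ʳ {xs = _ ∷ []}    [-]      refl r = r ∷ [-]
  Linked-∷ʳ {xs = _ ∷ _ ∷ _} (r ∷ rs) l    r′ = r ∷ Linked-∷ʳ rs l r′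

  Unique-++⁻ˡ : ∀ xs {ys : List A} → Unique (xs ++ ys) → Unique xs
  Unique-++⁻ˡ []       _          = []
  Unique-++⁻ˡ (_ ∷ xs) (x∉ ∷ us) = All.++⁻ˡ xs x∉ ∷ Unique-++⁻ˡ xs us

  Unique-++⁻ʳ : ∀ xs {ys : List A} → Unique (xs ++ ys) → Unique ys
  Unique-++⁻ʳ []       us       = us
  Unique-++⁻ʳ (_ ∷ xs) (_ ∷ us) = Unique-++⁻ʳ xs us

  Unique-reverse : ∀ {xs : List A} → Unique xs → Unique (reverse xs)
  Unique-reverse {[]}     _          = []
  Unique-reverse {x ∷ xs} (x∉ ∷ us) = subst Unique (sym (unfold-reverse x xs))
    (Unique.++⁺ (Unique-reverse us) ([] ∷ [])
      λ { (m , here refl) → All.lookup x∉ (Any.reverse⁻ m) refl })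

  AllPairs-either : ∀ {R : A → A → Set} {xs x y} → AllPairs R xs → x ∈ xs → y ∈ xs → x ≢ y → R x y ⊎ R y x
  AllPairs-either (_ ∷ _)  (here refl) (here refl) x≢y = ⊥-elim (x≢y refl)
  AllPairs-either (rs ∷ _) (here refl) (there y∈) _   = inj₁ (All.lookup rs y∈)
  AllPairs-either (rs ∷ _) (there x∈) (here refl) _   = inj₂ (All.lookup rs x∈)
  AllPairs-either (_ ∷ rs) (there x∈) (there y∈) x≢y = AllPairs-either rs x∈ y∈ x≢y

∧-true⁻ : ∀ {a b} → a ∧ b ≡ true → a ≡ true × b ≡ true
∧-true⁻ {true} {true} _ = refl , refl

∧-true⁺ : ∀ {a b} → a ≡ true → b ≡ true → a ∧ b ≡ true
∧-true⁺ refl refl = refl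

∨-true⁻ : ∀ {a b} → a ∨ b ≡ true → a ≡ true ⊎ b ≡ true
∨-true⁻ {true}  _ = inj₁ refl
∨-true⁻ {false} e = inj₂ e

∨-true⁺ʳ : ∀ a {b} → b ≡ true → a ∨ b ≡ true
∨-true⁺ʳ true  _    = refl
∨-true⁺ʳ false refl = refl

does-true⁻ : ∀ {P : Set} (P? : Dec P) → does P? ≡ true → P
does-true⁻ (yes p) _ = p

does-true⁺ : ∀ {P : Set} (P? : Dec P) → P → does P? ≡ true
does-true⁺ (yes _) _ = refl
does-true⁺ (no ¬p) p = ⊥-elim (¬p p)

any-true⁻ : ∀ {A : Set} (p : A → Bool) xs → any p xs ≡ true → ∃ λ x → x ∈ xs × p x ≡ true
any-true⁻ p xs e with find (Any.any⁻ p xs (Equivalence.from T-≡ e))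
... | x , x∈ , px = x , x∈ , Equivalence.to T-≡ px

any-true⁺ : ∀ {A : Set} (p : A → Bool) {xs x} → x ∈ xs → p x ≡ true → any p xs ≡ true
any-true⁺ p x∈ px = Equivalence.to T-≡ (Any.any⁺ p (lose x∈ (Equivalence.from T-≡ px)))

module Walks {N : ℕ} (H : SG N) where

  open import Data.List.Membership.DecPropositional (_≟ᶠ_ {N}) using (_∈?_)

  walk-∷ : ∀ {a b y q} → V H a ≡ true → E H a b ≡ true → Walk H b y q → Walk H a y (a ∷ q)
  walk-∷ {q = []}    _  _ (() , _)
  walk-∷ {q = _ ∷ _} va e (refl , l , vs , es) = refl , l , va ∷ vs , e ∷ es

  walk-last-V : ∀ {x y p} → Walk H x y p → V H y ≡ true
  walk-last-V (_ , l , vs , _) = All.lookup vs (last-∈ l)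

  walk-tail : ∀ {x a b y q} → Walk H x y (a ∷ b ∷ q) → Walk H b y (b ∷ q)
  walk-tail (_ , l , _ ∷ vs , _ ∷ es) = refl , l , vs , es

  walk-++ : ∀ p {x y z q} → Walk H x y p → Walk H y z (y ∷ q) → Walk H x z (p ++ q)
  walk-++ []          (() , _)
  walk-++ (_ ∷ [])    (refl , refl , _ , _) w′ = w′
  walk-++ (_ ∷ b ∷ p) w@(refl , _ , va ∷ _ , e ∷ _) w′ = walk-∷ va e (walk-++ (b ∷ p) (walk-tail w) w′)

  walk-∷ʳ : ∀ p {x y z} → Walk H x y p → E H y z ≡ true → V H z ≡ true → Walk H x z (p ∷ʳ z)
  walk-∷ʳ p w e vz = walk-++ p w (refl , refl , walk-last-V w ∷ vz ∷ [] , e ∷ [-])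

  walk-prefix : ∀ xs {v ys x y} → Walk H x y (xs ++ v ∷ ys) → Walk H x v (xs ∷ʳ v)
  walk-prefix xs {v} {ys} (h , _ , vs , es) =
    trans (head-++-∷ xs [] ys) h , last-∷ʳ xs v ,
    All.++⁻ˡ (xs ∷ʳ v) (subst (All _) (sym (++-assoc xs [ v ] ys)) vs) ,
    Linked-++⁻ˡ (xs ∷ʳ v) (subst (Linked _) (sym (++-assoc xs [ v ] ys)) es)

  walk-suffix : ∀ xs {v ys x y} → Walk H x y (xs ++ v ∷ ys) → Walk H v y (v ∷ ys)
  walk-suffix xs {v} {ys} (_ , l , vs , es) =
    refl , trans (sym (last-++-∷ xs v ys)) l , All.++⁻ʳ xs vs , Linked-++⁻ʳ xs es

  path-prefix : ∀ xs {v ys x y} → Path H x y (xs ++ v ∷ ys) → Path H x v (xs ∷ʳ v)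
  path-prefix xs {v} {ys} (w , us) =
    walk-prefix xs w , Unique-++⁻ˡ (xs ∷ʳ v) (subst Unique (sym (++-assoc xs [ v ] ys)) us)

  path-suffix : ∀ xs {v ys x y} → Path H x y (xs ++ v ∷ ys) → Path H v y (v ∷ ys)
  path-suffix xs (w , us) = walk-suffix xs w , Unique-++⁻ʳ xs us

  path-join : ∀ xs {z ys x y} → Path H x z (xs ∷ʳ z) → Path H z y (z ∷ ys) → Disjoint xs (z ∷ ys) → Path H x y (xs ++ z ∷ ys)
  path-join xs {z} {ys} (w , us) (w′ , us′) disjoint =
    subst (Walk H _ _) (++-assoc xs [ z ] ys) (walk-++ (xs ∷ʳ z) w w′) ,
    Unique.++⁺ (Unique-++⁻ˡ xs us) us′ disjoint

  path⇒Cycle : ∀ {x y C} → Path H x y C → 3 ≤ length C → E H y x ≡ true → Cycle H C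
  path⇒Cycle ((h , l , vs , es) , us) 3≤ e = 3≤ , vs , es , us , _ , _ , h , l , e

  walk-first-edge : ∀ {x a y c} q → Walk H x y (a ∷ q) → head q ≡ just c → E H a c ≡ true
  walk-first-edge (_ ∷ _) (_ , _ , _ , e ∷ _) refl = e

  path-drop-head : ∀ {x a y c} q → Path H x y (a ∷ q) → head q ≡ just c → Path H c y q
  path-drop-head (_ ∷ _) (w , _ ∷ us) refl = walk-tail w , us

  path-tail : ∀ {x a b y q} → Path H x y (a ∷ b ∷ q) → Path H b y (b ∷ q)
  path-tail (w , _ ∷ us) = walk-tail w , us

  walk⇒path : ∀ p {x y} → Walk H x y p → ∃ λ q → Path H x y q × length q ≤ length p
  walk⇒path []          (() , _)
  walk⇒path (a ∷ [])    w = a ∷ [] , (w , [] ∷ []) , ≤-refl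
  walk⇒path (a ∷ b ∷ p) w@(refl , _ , va ∷ _ , e ∷ _) with walk⇒path (b ∷ p) (walk-tail w)
  ... | q , π@(_ , us) , q≤ with a ∈? q
  ...   | no a∉q = a ∷ q , (walk-∷ va e (proj₁ π) , All.tabulate (λ m a≡ → a∉q (subst (_∈ q) (sym a≡) m)) ∷ us) , s≤s q≤
  ...   | yes a∈q with ∈-∃++ a∈q
  ...     | xs , ys , refl = a ∷ ys , path-suffix xs π ,
    (begin length (a ∷ ys)     ≤⟨ m≤n+m _ (length xs) ⟩
           length xs + length (a ∷ ys) ≡⟨ length-++ xs ⟨
           length (xs ++ a ∷ ys) ≤⟨ q≤ ⟩
           length (b ∷ p)      ≤⟨ n≤1+n _ ⟩
           length (a ∷ b ∷ p)  ∎)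
    where open ≤-Reasoning

  DistEq-unique : ∀ {x y d d′} → DistEq H x y d → DistEq H x y d′ → d ≡ d′
  DistEq-unique ((p , w , |p|) , min) ((p′ , w′ , |p′|) , min′) =
    suc-injective (≤-antisym (subst (_ ≤_) |p′| (min p′ w′)) (subst (_ ≤_) |p| (min′ p w)))

  module _ (E-sym : ∀ {a b} → E H a b ≡ true → E H b a ≡ true) where

    walk-reverse : ∀ p {x y} → Walk H x y p → Walk H y x (reverse p)
    walk-reverse []          (() , _)
    walk-reverse (_ ∷ [])    (refl , refl , vs , _) = refl , refl , vs , [-]
    walk-reverse (a ∷ b ∷ p) w@(refl , _ , va ∷ _ , e ∷ _) =
      subst (Walk H _ _) (sym (unfold-reverse a (b ∷ p)))
        (walk-∷ʳ (reverse (b ∷ p)) (walk-reverse (b ∷ p) (walk-tail w)) (E-sym e) va)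

    path-reverse : ∀ p {x y} → Path H x y p → Path H y x (reverse p)
    path-reverse p (w , us) = walk-reverse p w , Unique-reverse us

    connected-from : ∀ r → (∀ x → V H x ≡ true → ∃ λ p → Walk H r x p) → Connected H
    connected-from r walk-from x y vx vy with walk-from x vx | walk-from y vy
    ... | _ , _  | []    , (() , _)
    ... | p , wp | _ ∷ q , wq@(refl , _) = reverse p ++ q , walk-++ (reverse p) (walk-reverse p wp) wq

_⊑_ : ∀ {N} → SG N → SG N → Set
H′ ⊑ H = (∀ v → V H′ v ≡ true → V H v ≡ true) × (∀ a b → E H′ a b ≡ true → E H a b ≡ true)

module _ {N} {H′ H : SG N} (H′⊑H : H′ ⊑ H) where

  private
    V⊆ = proj₁ H′⊑H
    E⊆ = proj₂ H′⊑H

  walk-mono : ∀ {x y p} → Walk H′ x y p → Walk H x y p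
  walk-mono (h , l , vs , es) = h , l , All.map (V⊆ _) vs , Linked.map (E⊆ _ _) es

  path-mono : ∀ {x y p} → Path H′ x y p → Path H x y p
  path-mono (w , us) = walk-mono w , us

  Child-mono : ∀ {u v w} → Child H′ u v w → Child H u v w
  Child-mono (e , p , π , v∈p) = E⊆ _ _ e , p , path-mono π , v∈p

  Acyclic-mono : Acyclic H → Acyclic H′
  Acyclic-mono acyclic p (len , vs , es , us , x , y , h , l , e) =
    acyclic p (len , All.map (V⊆ _) vs , Linked.map (E⊆ _ _) es , us , x , y , h , l , E⊆ _ _ e)

  DistEq-mono : ∀ {x y d p} → DistEq H x y d → Walk H′ x y p → length p ≡ suc d → DistEq H′ x y d
  DistEq-mono (_ , min) w |p| = (_ , w , |p|) , λ q w′ → min q (walk-mono w′)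

module Forest {N : ℕ} (H : SG N) (E-sym : ∀ {a b} → E H a b ≡ true → E H b a ≡ true) (acyclic : Acyclic H) where

  open Walks H
  open import Data.List.Membership.DecPropositional (_≟ᶠ_ {N}) using (_∈?_)

  split-at-first : ∀ (Q : List (Fin N)) P {x} → x ∈ P → x ∈ Q →
                   ∃₂ λ X z → ∃ λ Y → P ≡ X ++ z ∷ Y × All (_∉ Q) X × z ∈ Q
  split-at-first Q P x∈P x∈Q with First.first (λ y → Sum.swap (toSum (y ∈? Q))) P
  ... | inj₂ none = ⊥-elim (All.lookup none x∈P x∈Q)
  ... | inj₁ f with toView f
  ...   | First._++_∷_ {X} {z} X∉Q z∈Q Y = X , z , Y , refl , X∉Q , z∈Q

  private
    3≤length : ∀ (a : Fin N) X z U → ¬ (X ≡ [] × U ≡ []) → 3 ≤ length (a ∷ X ++ z ∷ reverse U)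
    3≤length a []          z []      ne = ⊥-elim (ne (refl , refl))
    3≤length a []          z (x ∷ U) _  = s≤s (s≤s (subst (1 ≤_) (sym (length-reverse (x ∷ U))) (s≤s z≤n)))
    3≤length a (_ ∷ [])    z U       _  = s≤s (s≤s (s≤s z≤n))
    3≤length a (_ ∷ _ ∷ _) z U       _  = s≤s (s≤s (s≤s z≤n))

  -- Two paths leaving a through different neighbours p, q close up, at their first common
  -- vertex z, into the cycle a X z (reverse U) q.
  fork-impossible : ∀ {a b p q} P Q → Path H a b (a ∷ P) → Path H a b (a ∷ Q) →
                    head P ≡ just p → head Q ≡ just q → p ≢ q → ⊥
  fork-impossible {a} {q = q} P Q πP πQ hP hQ p≢q
    with split-at-first Q P (last-∈-tail P hP (proj₁ (proj₂ (proj₁ πP)))) (last-∈-tail Q hQ (proj₁ (proj₂ (proj₁ πQ))))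
  ... | X , z , Y , refl , X∉Q , z∈Q with ∈-∃++ z∈Q
  ...   | U , W , refl =
    acyclic (a ∷ X ++ z ∷ reverse U) (path⇒Cycle π (3≤length a X z U not-both-empty) (E-sym (walk-first-edge (U ++ z ∷ W) (proj₁ πQ) hQ)))
    where
    πU : Path H z q (z ∷ reverse U)
    πU = subst (Path H _ _) (reverse-++ U [ z ]) (path-reverse E-sym (U ∷ʳ z) (path-prefix U (path-drop-head (U ++ z ∷ W) πQ hQ)))
    ⊆Q : ∀ {m} → m ∈ z ∷ reverse U → m ∈ U ++ z ∷ W
    ⊆Q (here refl) = ∈-++⁺ʳ U (here refl)
    ⊆Q (there m)   = ∈-++⁺ˡ (Any.reverse⁻ {xs = U} m)
    disjoint : Disjoint (a ∷ X) (z ∷ reverse U)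
    disjoint (here refl , m) = All.lookup (AllPairs.head (proj₂ πQ)) (⊆Q m) refl
    disjoint (there x , m)   = All.lookup X∉Q x (⊆Q m)
    π : Path H a q (a ∷ X ++ z ∷ reverse U)
    π = path-join (a ∷ X) (path-prefix (a ∷ X) πP) πU disjoint
    not-both-empty : ¬ (X ≡ [] × U ≡ [])
    not-both-empty (refl , refl) = p≢q (just-injective (trans (sym hP) hQ))

  private
    tails-unique : ∀ {a y} P Q → (∀ Q′ {x} → Path H x y P → Path H x y Q′ → P ≡ Q′) →
                   Path H a y (a ∷ P) → Path H a y (a ∷ Q) → P ≡ Q
    tails-unique []      []      _  _ _ = refl
    tails-unique []      (_ ∷ Q) _  ((_ , refl , _) , _) ((_ , l , _) , a∉ ∷ _) = ⊥-elim (All.lookup a∉ (last-∈ l) refl)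
    tails-unique (_ ∷ P) []      _  ((_ , l , _) , a∉ ∷ _) ((_ , refl , _) , _) = ⊥-elim (All.lookup a∉ (last-∈ l) refl)
    tails-unique (p ∷ P) (q ∷ Q) ih πP πQ with p ≟ᶠ q
    ... | yes refl = ih (q ∷ Q) (path-tail πP) (path-tail πQ)
    ... | no p≢q   = ⊥-elim (fork-impossible (p ∷ P) (q ∷ Q) πP πQ refl refl p≢q)

  paths-unique : ∀ {x y} P Q → Path H x y P → Path H x y Q → P ≡ Q
  paths-unique []      _       ((() , _) , _) _
  paths-unique (_ ∷ _) []      _ ((() , _) , _)
  paths-unique (a ∷ P) (_ ∷ Q) πP@((refl , _) , _) πQ@((refl , _) , _) =
    cong (a ∷_) (tails-unique P Q (λ Q′ → paths-unique P Q′) πP πQ)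

  Child⇒DistEq-suc : (∀ x → E H x x ≢ true) → ∀ {u v w dv dw} →
                     DistEq H u v dv → DistEq H u w dw → Child H u v w → dw ≡ suc dv
  Child⇒DistEq-suc loopless {_} {v} {w} {dv} {dw} ((pv , wv , |pv|) , min-v) ((pw , ww , |pw|) , min-w) (vw , P , πP , v∈P) =
    ≤-antisym upper lower
    where
    upper : dw ≤ suc dv
    upper = ≤-pred (begin
      suc dw                 ≤⟨ min-w (pv ∷ʳ w) (walk-∷ʳ pv wv vw (walk-last-V ww)) ⟩
      length (pv ∷ʳ w)       ≡⟨ length-++ pv ⟩
      length pv + 1          ≡⟨ cong (_+ 1) |pv| ⟩
      suc dv + 1             ≡⟨ +-comm (suc dv) 1 ⟩
      suc (suc dv)           ∎)
      where open ≤-Reasoning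
    lower : suc dv ≤ dw
    lower with walk⇒path pw ww
    ... | Q , πQ , Q≤ with ∈-∃++ (subst (v ∈_) (paths-unique P Q πP πQ) v∈P)
    ...   | A , [] , refl = ⊥-elim (loopless v (subst (λ x → E H v x ≡ true) (sym v≡w) vw))
      where v≡w = just-injective (trans (sym (last-∷ʳ A v)) (proj₁ (proj₂ (proj₁ πQ))))
    ...   | A , b ∷ B , refl = ≤-pred (begin
      suc (suc dv)                ≤⟨ s≤s (min-v (A ∷ʳ v) (walk-prefix A (proj₁ πQ))) ⟩
      suc (length (A ∷ʳ v))       ≡⟨ cong suc (length-++ A) ⟩
      suc (length A + 1)          ≡⟨ +-suc (length A) 1 ⟨
      length A + 2                ≤⟨ +-monoʳ-≤ (length A) (s≤s (s≤s z≤n)) ⟩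
      length A + length (v ∷ b ∷ B) ≡⟨ length-++ A ⟨
      length (A ++ v ∷ b ∷ B)     ≤⟨ Q≤ ⟩
      length pw                   ≡⟨ |pw| ⟩
      suc dw                      ∎)
      where open ≤-Reasoning

[1+m]^n+m^[1+n]≤[1+m]^[1+n] : ∀ m n → suc m ^ n + m ^ suc n ≤ suc m ^ suc n
[1+m]^n+m^[1+n]≤[1+m]^[1+n] m zero    = ≤-refl
[1+m]^n+m^[1+n]≤[1+m]^[1+n] m (suc n) = begin
  suc m * suc m ^ n + m * m ^ suc n        ≤⟨ +-monoʳ-≤ (suc m * suc m ^ n) (m≤n+m (m * m ^ suc n) (m ^ suc n)) ⟩
  suc m * suc m ^ n + suc m * m ^ suc n    ≡⟨ *-distribˡ-+ (suc m) (suc m ^ n) (m ^ suc n) ⟨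
  suc m * (suc m ^ n + m ^ suc n)          ≤⟨ *-monoʳ-≤ (suc m) ([1+m]^n+m^[1+n]≤[1+m]^[1+n] m n) ⟩
  suc m * suc m ^ suc n                    ∎
  where open ≤-Reasoning

length-filter+length-filter-∁ : ∀ {A : Set} {P : A → Set} (P? : Decidable P) xs →
                                length (filter P? xs) + length (filter (∁? P?) xs) ≡ length xs
length-filter+length-filter-∁ P? []       = refl
length-filter+length-filter-∁ P? (x ∷ xs) with does (P? x)
... | true  = cong suc (length-filter+length-filter-∁ P? xs)
... | false = trans (+-suc _ _) (cong suc (length-filter+length-filter-∁ P? xs))

module Ramsey {A : Set} (R : A → A → Set) (R? : ∀ a b → Dec (R a b)) (R-sym : ∀ {a b} → R a b → R b a) where

  Clique : ℕ → List A → Set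
  Clique k xs = Σ (Fin k → A) λ f → (∀ i → f i ∈ xs) × (∀ i j → i ≢ j → f i ≢ f j × R (f i) (f j))

  IndependentSet : ℕ → List A → Set
  IndependentSet k xs = Σ (List A) λ ys → length ys ≡ k × (∀ {y} → y ∈ ys → y ∈ xs)
                                        × AllPairs (λ a b → a ≢ b × ¬ R a b) ys

  private
    clique-∷ : ∀ {k x xs ys} → x ∉ ys → (∀ {y} → y ∈ ys → y ∈ xs × R x y) → Clique k ys → Clique (suc k) (x ∷ xs)
    clique-∷ {x = x} x∉ ys⊆ (f , f∈ , f-pairs) = g , g∈ , g-pairs
      where
      g : Fin _ → _
      g zero    = x
      g (suc i) = f i
      g∈ : ∀ i → g i ∈ x ∷ _
      g∈ zero    = here refl
      g∈ (suc i) = there (proj₁ (ys⊆ (f∈ i)))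
      g-pairs : ∀ i j → i ≢ j → g i ≢ g j × R (g i) (g j)
      g-pairs zero    zero    i≢j = ⊥-elim (i≢j refl)
      g-pairs zero    (suc j) _   = (λ x≡ → x∉ (subst (_∈ _) (sym x≡) (f∈ j))) , proj₂ (ys⊆ (f∈ j))
      g-pairs (suc i) zero    _   = (λ ≡x → x∉ (subst (_∈ _) ≡x (f∈ i))) , R-sym (proj₂ (ys⊆ (f∈ i)))
      g-pairs (suc i) (suc j) i≢j = f-pairs i j (λ i≡j → i≢j (cong suc i≡j))

    clique-⊆ : ∀ {k xs ys} → (∀ {y} → y ∈ ys → y ∈ xs) → Clique k ys → Clique k xs
    clique-⊆ ys⊆ (f , f∈ , f-pairs) = f , (λ i → ys⊆ (f∈ i)) , f-pairs

    independent-∷ : ∀ {k x xs ys} → x ∉ ys → (∀ {y} → y ∈ ys → y ∈ xs × ¬ R x y) →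
                    IndependentSet k ys → IndependentSet (suc k) (x ∷ xs)
    independent-∷ {x = x} x∉ ys⊆ (zs , |zs| , zs⊆ , pairs) =
      x ∷ zs , cong suc |zs| , x∷zs⊆ ,
      All.tabulate (λ z∈ → (λ x≡ → x∉ (subst (_∈ _) (sym x≡) (zs⊆ z∈))) , proj₂ (ys⊆ (zs⊆ z∈))) ∷ pairs
      where
      x∷zs⊆ : ∀ {y} → y ∈ x ∷ zs → y ∈ x ∷ _
      x∷zs⊆ (here refl) = here refl
      x∷zs⊆ (there y∈)  = there (proj₁ (ys⊆ (zs⊆ y∈)))

    independent-⊆ : ∀ {k xs ys} → (∀ {y} → y ∈ ys → y ∈ xs) → IndependentSet k ys → IndependentSet k xs
    independent-⊆ ys⊆ (zs , |zs| , zs⊆ , pairs) = zs , |zs| , ys⊆ ∘ zs⊆ , pairs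

  ramsey : ∀ s t xs → Unique xs → suc s ^ t ≤ length xs → Clique (suc s) xs ⊎ IndependentSet (suc t) xs
  ramsey s       t       []       _ big = ⊥-elim (<⇒≱ (m^n>0 (suc s) t) big)
  ramsey zero    t       (x ∷ xs) _ _   = inj₁ ((λ _ → x) , (λ _ → here refl) , λ { zero zero i≢j → ⊥-elim (i≢j refl) })
  ramsey (suc s) zero    (x ∷ xs) _ _   = inj₂ (x ∷ [] , refl , (λ { (here refl) → here refl }) , [] ∷ [])
  ramsey (suc s) (suc t) (x ∷ xs) (x∉xs ∷ uxs) big with suc s ^ suc t ≤? length (filter (R? x) xs)
  ... | yes many-neighbours with ramsey s (suc t) (filter (R? x) xs) (Unique.filter⁺ (R? x) uxs) many-neighbours
  ...   | inj₁ clique      = inj₁ (clique-∷ (λ x∈ → All.lookup x∉xs (proj₁ (∈-filter⁻ (R? x) x∈)) refl) (∈-filter⁻ (R? x)) clique)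
  ...   | inj₂ independent = inj₂ (independent-⊆ (there ∘ proj₁ ∘ ∈-filter⁻ (R? x)) independent)
  ramsey (suc s) (suc t) (x ∷ xs) (x∉xs ∷ uxs) big | no few-neighbours
    with ramsey (suc s) t (filter (∁? (R? x)) xs) (Unique.filter⁺ (∁? (R? x)) uxs) many-non-neighbours
    where
    many-non-neighbours : suc (suc s) ^ t ≤ length (filter (∁? (R? x)) xs)
    many-non-neighbours = +-cancelˡ-≤ (suc (length (filter (R? x) xs))) _ _ (begin
      suc (length (filter (R? x) xs)) + suc (suc s) ^ t   ≤⟨ +-monoˡ-≤ _ (≰⇒> few-neighbours) ⟩
      suc s ^ suc t + suc (suc s) ^ t                     ≡⟨ +-comm (suc s ^ suc t) _ ⟩
      suc (suc s) ^ t + suc s ^ suc t                     ≤⟨ [1+m]^n+m^[1+n]≤[1+m]^[1+n] (suc s) t ⟩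
      suc (suc s) ^ suc t                                 ≤⟨ big ⟩
      suc (length xs)                                     ≡⟨ cong suc (length-filter+length-filter-∁ (R? x) xs) ⟨
      suc (length (filter (R? x) xs)) + length (filter (∁? (R? x)) xs) ∎)
      where open ≤-Reasoning
  ... | inj₁ clique      = inj₁ (clique-⊆ (there ∘ proj₁ ∘ ∈-filter⁻ (∁? (R? x))) clique)
  ... | inj₂ independent = inj₂ (independent-∷ (λ x∈ → All.lookup x∉xs (proj₁ (∈-filter⁻ (∁? (R? x)) x∈)) refl) (∈-filter⁻ (∁? (R? x))) independent)

  select-independent : ∀ s t xs → Unique xs → Σ (List A) λ ys → (∀ {y} → y ∈ ys → y ∈ xs) ×
                       (suc s ^ t ≤ length xs → ¬ Clique (suc s) xs →
                        length ys ≡ suc t × AllPairs (λ a b → a ≢ b × ¬ R a b) ys)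
  select-independent s t xs uxs with suc s ^ t ≤? length xs
  ... | no small = [] , (λ ()) , λ big → ⊥-elim (small big)
  ... | yes big with ramsey s t xs uxs big
  ...   | inj₁ clique                    = [] , (λ ()) , λ _ no-clique → ⊥-elim (no-clique clique)
  ...   | inj₂ (ys , |ys| , ys⊆ , pairs) = ys , ys⊆ , λ _ _ → |ys| , pairs

-- Induced G B is restrict B (adj G) by definition.
restrict : ∀ {N} → (Fin N → Bool) → (Fin N → Fin N → Bool) → SG N
restrict B E′ = record { V = B ; E = λ x y → B x ∧ B y ∧ E′ x y }

module _ {N} {B : Fin N → Bool} {E′ : Fin N → Fin N → Bool} where

  walk-restrict : ∀ {R : Fin N → Fin N → Set} → (∀ {a b} → R a b → E′ a b ≡ true) →
                  ∀ {x y p} → head p ≡ just x → last p ≡ just y → All (λ v → B v ≡ true) p → Linked R p →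
                  Walk (restrict B E′) x y p
  walk-restrict {R} R⇒E′ h l Bs Rs = h , l , Bs , edges Bs Rs
    where
    edges : ∀ {p} → All (λ v → B v ≡ true) p → Linked R p → Linked (λ a b → E (restrict B E′) a b ≡ true) p
    edges _                  []       = []
    edges _                  [-]      = [-]
    edges (Ba ∷ Bs@(Bb ∷ _)) (r ∷ rs) = ∧-true⁺ Ba (∧-true⁺ Bb (R⇒E′ r)) ∷ edges Bs rs

  restrict-sym : (∀ {a b} → E′ a b ≡ true → E′ b a ≡ true) →
                 ∀ {a b} → E (restrict B E′) a b ≡ true → E (restrict B E′) b a ≡ true
  restrict-sym E′-sym {a} e with ∧-true⁻ {B a} e
  ... | Ba , e′ with ∧-true⁻ e′
  ...   | Bb , Eab = ∧-true⁺ Bb (∧-true⁺ Ba (E′-sym Eab))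

module RegularTree {N : ℕ} (T : SG N) (u : Fin N)
  (E-sym : ∀ {a b} → E T a b ≡ true → E T b a ≡ true)
  (E-ends : ∀ {a b} → E T a b ≡ true → V T a ≡ true × V T b ≡ true)
  (loopless : ∀ x → E T x x ≢ true) (acyclic : Acyclic T) (Vu : V T u ≡ true)
  {Δ ρ : ℕ} (regular : Regular T u Δ ρ) where

  open Walks T
  open Forest T E-sym acyclic

  private
    depth-at : ∀ v → Dec (V T v ≡ true) → ℕ
    depth-at v (yes Vv) = proj₁ (proj₁ regular v Vv)
    depth-at v (no _)   = 0

    depth-at-spec : ∀ v V? → V T v ≡ true → depth-at v V? ≤ ρ × DistEq T u v (depth-at v V?)
    depth-at-spec v (yes Vv) _  = proj₂ (proj₁ regular v Vv)
    depth-at-spec v (no ¬Vv) Vv = ⊥-elim (¬Vv Vv)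

  depth : Fin N → ℕ
  depth v = depth-at v (V T v ≟ᵇ true)

  depth≤ρ : ∀ {v} → V T v ≡ true → depth v ≤ ρ
  depth≤ρ {v} Vv = proj₁ (depth-at-spec v (V T v ≟ᵇ true) Vv)

  depth-DistEq : ∀ {v} → V T v ≡ true → DistEq T u v (depth v)
  depth-DistEq {v} Vv = proj₂ (depth-at-spec v (V T v ≟ᵇ true) Vv)

  depth-root : depth u ≡ 0
  depth-root = DistEq-unique (depth-DistEq Vu) ((u ∷ [] , (refl , refl , Vu ∷ [] , [-]) , refl) , shortest)
    where
    shortest : ∀ p → Walk T u u p → 1 ≤ length p
    shortest []      (() , _)
    shortest (_ ∷ _) _ = s≤s z≤n

  Child⇒depth : ∀ {v w} → Child T u v w → depth w ≡ suc (depth v)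
  Child⇒depth vw@(e , _) = Child⇒DistEq-suc loopless (depth-DistEq (proj₁ (E-ends e))) (depth-DistEq (proj₂ (E-ends e))) vw

  private
    children-at : ∀ v → Dec (V T v ≡ true) → Dec (depth v ≡ ρ) → Σ (List (Fin N)) λ cs →
                  Unique cs × (∀ {w} → w ∈ cs → Child T u v w) × (V T v ≡ true → depth v ≢ ρ → length cs ≡ Δ)
    children-at v (yes Vv) (no d≢ρ) with proj₂ regular v Vv (d≢ρ ∘ DistEq-unique (depth-DistEq Vv))
    ... | cs , |cs| , ucs , cs↔ = cs , ucs , (λ w∈ → proj₁ (cs↔ _) w∈) , λ _ _ → |cs|
    children-at v (yes _)  (yes d≡ρ) = [] , [] , (λ ()) , λ _ d≢ρ → ⊥-elim (d≢ρ d≡ρ)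
    children-at v (no ¬Vv) _         = [] , [] , (λ ()) , λ Vv → ⊥-elim (¬Vv Vv)

  children : Fin N → List (Fin N)
  children v = proj₁ (children-at v (V T v ≟ᵇ true) (depth v ≟ ρ))

  children-unique : ∀ v → Unique (children v)
  children-unique v = proj₁ (proj₂ (children-at v (V T v ≟ᵇ true) (depth v ≟ ρ)))

  ∈-children⇒Child : ∀ {v w} → w ∈ children v → Child T u v w
  ∈-children⇒Child {v} = proj₁ (proj₂ (proj₂ (children-at v (V T v ≟ᵇ true) (depth v ≟ ρ))))

  length-children : ∀ {v} → V T v ≡ true → depth v ≢ ρ → length (children v) ≡ Δ
  length-children {v} = proj₂ (proj₂ (proj₂ (children-at v (V T v ≟ᵇ true) (depth v ≟ ρ))))

  descending-unique : ∀ {C} → Linked (Child T u) C → Unique C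
  descending-unique chs = AllPairs.map (λ lt eq → <-irrefl (cong depth eq) lt)
    (Linked⇒AllPairs <-trans (Linked.map (λ ch → ≤-reflexive (sym (Child⇒depth ch))) chs))

  descending-path : ∀ {v x C} → V T v ≡ true → head C ≡ just v → last C ≡ just x → Linked (Child T u) C → Path T v x C
  descending-path Vv h l chs = walk Vv h l chs , descending-unique chs
    where
    walk : ∀ {v x C} → V T v ≡ true → head C ≡ just v → last C ≡ just x → Linked (Child T u) C → Walk T v x C
    walk {C = _ ∷ []}    Vv refl refl [-]        = refl , refl , Vv ∷ [] , [-]
    walk {C = _ ∷ _ ∷ _} Vv refl l    (ch ∷ chs) = walk-∷ Vv (proj₁ ch) (walk (proj₂ (E-ends (proj₁ ch))) refl l chs)

module Construction {s t ρ Δ : ℕ} (G : Graph) (no-minor : ¬ HasCliqueMinor G (suc (suc s)))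
  (T : SG (n G)) (T⊆G : IsSubgraph G T) (u : Fin (n G)) (rooted : IsRootedTree T u)
  (Δ-large : suc s ^ t ≤ Δ) (regular : Regular T u Δ ρ) where

  private
    N = n G

  E⇒adj : ∀ {a b} → E T a b ≡ true → adj G a b ≡ true
  E⇒adj e = proj₂ (proj₂ (proj₂ T⊆G _ _ e))

  E-ends : ∀ {a b} → E T a b ≡ true → V T a ≡ true × V T b ≡ true
  E-ends e = proj₁ (proj₂ T⊆G _ _ e) , proj₁ (proj₂ (proj₂ T⊆G _ _ e))

  E-sym : ∀ {a b} → E T a b ≡ true → E T b a ≡ true
  E-sym {a} {b} e = trans (sym (proj₁ T⊆G a b)) e

  adj-sym : ∀ {a b} → adj G a b ≡ true → adj G b a ≡ true
  adj-sym {a} {b} e = trans (Graph.sym G b a) e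

  loopless : ∀ x → E T x x ≢ true
  loopless x e with trans (sym (E⇒adj e)) (irrefl G x)
  ... | ()

  acyclic : Acyclic T
  acyclic = proj₂ (proj₂ (proj₁ rooted))

  open Walks T
  open Forest T E-sym acyclic
  open RegularTree T u E-sym E-ends loopless acyclic (proj₂ rooted) regular

  AtHeight : ℕ → Fin N → Set
  AtHeight h v = V T v ≡ true × depth v + h ≡ ρ

  AtHeight⇒depth≢ρ : ∀ {h v} → AtHeight (suc h) v → depth v ≢ ρ
  AtHeight⇒depth≢ρ {v = v} (_ , e) d≡ρ = m+1+n≢m (depth v) (trans e (sym d≡ρ))

  AtHeight-child : ∀ {h v c} → AtHeight (suc h) v → Child T u v c → AtHeight h c
  AtHeight-child {h} {v} (_ , e) vc =
    proj₂ (E-ends (proj₁ vc)) , trans (cong (_+ h) (Child⇒depth vc)) (trans (sym (+-suc (depth v) h)) e)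

  AtHeight⇒ρ∸[1+depth]≡h : ∀ {h v} → AtHeight (suc h) v → ρ ∸ suc (depth v) ≡ h
  AtHeight⇒ρ∸[1+depth]≡h {h} {v} (_ , e) = trans (cong (_∸ suc (depth v)) (trans (sym e) (+-suc (depth v) h))) (m+n∸m≡n (suc (depth v)) h)

  -- Subtree h v is the vertex set of the (δ, h)-regular branch-induced subtree grown at v; its
  -- children are chosen among those of v by Ramsey so that their subtrees are pairwise non-adjacent.
  mutual
    Subtree : ℕ → Fin N → Fin N → Bool
    Subtree zero    v x = does (x ≟ᶠ v)
    Subtree (suc h) v x = does (x ≟ᶠ v) ∨ any (λ c → Subtree h c x) (chosen h v)

    SubtreesAdjacent : ℕ → Fin N → Fin N → Set
    SubtreesAdjacent h a b = ∃₂ λ x y → Subtree h a x ≡ true × Subtree h b y ≡ true × adj G x y ≡ true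

    subtrees-adjacent? : ∀ h a b → Dec (SubtreesAdjacent h a b)
    subtrees-adjacent? h a b = any? λ x → any? λ y →
      (Subtree h a x ≟ᵇ true) ×-dec (Subtree h b y ≟ᵇ true) ×-dec (adj G x y ≟ᵇ true)

    SubtreesAdjacent-sym : ∀ h {a b} → SubtreesAdjacent h a b → SubtreesAdjacent h b a
    SubtreesAdjacent-sym h (x , y , x∈ , y∈ , xy) = y , x , y∈ , x∈ , adj-sym xy

    chosen : ℕ → Fin N → List (Fin N)
    chosen h v = proj₁ (Ramsey.select-independent (SubtreesAdjacent h) (subtrees-adjacent? h) (SubtreesAdjacent-sym h)
                          s t (children v) (children-unique v))

  module Adjacency (h : ℕ) = Ramsey (SubtreesAdjacent h) (subtrees-adjacent? h) (SubtreesAdjacent-sym h)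

  chosen⊆children : ∀ {h v c} → c ∈ chosen h v → c ∈ children v
  chosen⊆children {h} {v} = proj₁ (proj₂ (Adjacency.select-independent h s t (children v) (children-unique v)))

  Subtree-root : ∀ h v → Subtree h v v ≡ true
  Subtree-root zero    v = does-true⁺ (v ≟ᶠ v) refl
  Subtree-root (suc h) v = cong (_∨ any (λ c → Subtree h c v) (chosen h v)) (does-true⁺ (v ≟ᶠ v) refl)

  Subtree-zero : ∀ {v x} → Subtree zero v x ≡ true → x ≡ v
  Subtree-zero {v} {x} = does-true⁻ (x ≟ᶠ v)

  Subtree-cases : ∀ {h v x} → Subtree (suc h) v x ≡ true → x ≡ v ⊎ ∃ λ c → c ∈ chosen h v × Subtree h c x ≡ true
  Subtree-cases {h} {v} {x} = Sum.map (does-true⁻ (x ≟ᶠ v)) (any-true⁻ (λ c → Subtree h c x) (chosen h v)) ∘ ∨-true⁻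

  Subtree-child : ∀ {h v c x} → c ∈ chosen h v → Subtree h c x ≡ true → Subtree (suc h) v x ≡ true
  Subtree-child {h} {v} {c} {x} c∈ x∈ = ∨-true⁺ʳ (does (x ≟ᶠ v)) (any-true⁺ (λ c → Subtree h c x) c∈ x∈)

  Step : Fin N → Fin N → Set
  Step a b = b ∈ chosen (ρ ∸ suc (depth a)) a

  Step⇒Child : ∀ {a b} → Step a b → Child T u a b
  Step⇒Child {a} = ∈-children⇒Child ∘ chosen⊆children {ρ ∸ suc (depth a)} {a}

  Chain : Fin N → Fin N → List (Fin N) → Set
  Chain v x C = head C ≡ just v × last C ≡ just x × Linked Step C

  ChainIn : ℕ → Fin N → Fin N → List (Fin N) → Set
  ChainIn h v x C = Chain v x C × All (λ y → Subtree h v y ≡ true) C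

  chainIn-cons : ∀ {h v c x C} → AtHeight (suc h) v → c ∈ chosen h v → ChainIn h c x C → ChainIn (suc h) v x (v ∷ C)
  chainIn-cons {C = []}    _  _  ((() , _) , _)
  chainIn-cons {h} {v} {C = _ ∷ _} at c∈ ((refl , l , sts) , C⊆) =
    (refl , l , subst (λ k → _ ∈ chosen k v) (sym (AtHeight⇒ρ∸[1+depth]≡h at)) c∈ ∷ sts) ,
    Subtree-root (suc h) v ∷ All.map (Subtree-child {h} {v} c∈) C⊆

  Subtree-sound : ∀ h {v x} → AtHeight h v → Subtree h v x ≡ true → ∃ (ChainIn h v x)
  Subtree-sound zero {v} {x} _ x∈ with Subtree-zero {v} {x} x∈
  ... | refl = v ∷ [] , (refl , refl , [-]) , Subtree-root zero v ∷ []
  Subtree-sound (suc h) {v} {x} at x∈ with Subtree-cases {h} {v} {x} x∈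
  ... | inj₁ refl = v ∷ [] , (refl , refl , [-]) , Subtree-root (suc h) v ∷ []
  ... | inj₂ (c , c∈ , x∈c) with Subtree-sound h (AtHeight-child at (∈-children⇒Child (chosen⊆children {h} {v} c∈))) x∈c
  ...   | C , chain = v ∷ C , chainIn-cons at c∈ chain

  Child⇒depth<ρ : ∀ {v w} → Child T u v w → depth v < ρ
  Child⇒depth<ρ vw = subst (_≤ ρ) (Child⇒depth vw) (depth≤ρ (proj₂ (E-ends (proj₁ vw))))

  Subtree-complete : ∀ h {v x C} → AtHeight h v → Chain v x C → Subtree h v x ≡ true
  Subtree-complete h       {C = _ ∷ []}    _            (refl , refl , _) = Subtree-root h _
  Subtree-complete zero    {C = _ ∷ _ ∷ _} (_ , d+0≡ρ) (refl , _ , st ∷ _) =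
    ⊥-elim (<-irrefl (trans (sym (+-identityʳ _)) d+0≡ρ) (Child⇒depth<ρ (Step⇒Child st)))
  Subtree-complete (suc h) {v} {C = _ ∷ c ∷ _} at (refl , l , st ∷ sts) =
    Subtree-child {h} {v} c∈ (Subtree-complete h (AtHeight-child at (Step⇒Child st)) (refl , l , sts))
    where
    c∈ : c ∈ chosen h v
    c∈ = subst (λ k → c ∈ chosen k v) (AtHeight⇒ρ∸[1+depth]≡h at) st

  chain-length : ∀ {v x} C → Chain v x C → length C + depth v ≡ suc (depth x)
  chain-length (_ ∷ [])        (refl , refl , _)      = refl
  chain-length {v} {x} (_ ∷ c ∷ C) (refl , l , st ∷ sts) = begin
    suc (length (c ∷ C)) + depth v   ≡⟨ +-suc (length (c ∷ C)) (depth v) ⟨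
    length (c ∷ C) + suc (depth v)   ≡⟨ cong (length (c ∷ C) +_) (Child⇒depth (Step⇒Child st)) ⟨
    length (c ∷ C) + depth c         ≡⟨ chain-length (c ∷ C) (refl , l , sts) ⟩
    suc (depth x)                    ∎
    where open ≡-Reasoning

  -- Depths grow by one along a chain, so the only vertex one level shallower than its end is its predecessor.
  Chain⇒Step-into-end : ∀ {v x y} C → Chain v x C → y ∈ C → suc (depth y) ≡ depth x → Step y x
  Chain⇒Step-into-end (_ ∷ [])        (refl , refl , _)     (here refl) e = ⊥-elim (1+n≢n e)
  Chain⇒Step-into-end (_ ∷ _ ∷ [])    (refl , refl , st ∷ _) (here refl) _ = st
  Chain⇒Step-into-end {x = x} (_ ∷ b ∷ c ∷ C) (refl , l , st ∷ sts) (here refl) e = ⊥-elim (1+n≰n (begin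
    suc (suc (depth x))                 ≤⟨ s≤s (s≤s (m≤n+m (depth x) (length C))) ⟩
    suc (suc (length C + depth x))      ≡⟨ cong (λ d → suc (suc (length C + d))) (trans (Child⇒depth (Step⇒Child st)) e) ⟨
    length (b ∷ c ∷ C) + depth b        ≡⟨ chain-length (b ∷ c ∷ C) (refl , l , sts) ⟩
    suc (depth x)                       ∎))
    where open ≤-Reasoning
  Chain⇒Step-into-end (_ ∷ b ∷ C) (refl , l , _ ∷ sts) (there y∈) e = Chain⇒Step-into-end (b ∷ C) (refl , l , sts) y∈ e

  child-chain-path : ∀ {v c x C} → Child T u v c → Chain c x C → Path T v x (v ∷ C)
  child-chain-path {C = []}    _  (() , _)
  child-chain-path {C = _ ∷ _} vc (refl , l , sts) =
    descending-path (proj₁ (E-ends (proj₁ vc))) refl l (vc ∷ Linked.map Step⇒Child sts)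

  Subtree-connected : ∀ {h c} → AtHeight h c → Connected (Induced G (Subtree h c))
  Subtree-connected {h} {c} at = Walks.connected-from (Induced G (Subtree h c)) (restrict-sym {B = Subtree h c} adj-sym) c walk-from-c
    where
    walk-from-c : ∀ x → Subtree h c x ≡ true → ∃ λ C → Walk (Induced G (Subtree h c)) c x C
    walk-from-c x x∈ with Subtree-sound h at x∈
    ... | C , (hd , l , sts) , C⊆ = C , walk-restrict (E⇒adj ∘ proj₁ ∘ Step⇒Child) hd l C⊆ sts

  point-connected : ∀ v → Connected (Induced G (Subtree zero v))
  point-connected v x y x∈ y∈ with Subtree-zero {v} {x} x∈ | Subtree-zero {v} {y} y∈
  ... | refl | refl = v ∷ [] , refl , refl , Subtree-root zero v ∷ [] , [-]

  Subtree-∌-parent : ∀ {h v c} → Child T u v c → AtHeight h c → Subtree h c v ≢ true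
  Subtree-∌-parent {h} vc at v∈ with Subtree-sound h at v∈
  ... | C , ch@(hC , _) , _ with child-chain-path vc ch
  ...   | (_ , l , _) , v∉ ∷ _ = All.lookup v∉ (last-∈-tail C hC l) refl

  -- Distinct children of v have disjoint subtrees, as a common vertex would be reached from v along two paths.
  children-subtrees-disjoint : ∀ {h v c₁ c₂ x} → AtHeight (suc h) v → c₁ ∈ children v → c₂ ∈ children v → c₁ ≢ c₂ →
                               Subtree h c₁ x ≡ true → Subtree h c₂ x ≢ true
  children-subtrees-disjoint {h} {_} {c₁} {c₂} at c₁∈ c₂∈ c₁≢c₂ x∈₁ x∈₂
    with Subtree-sound h (AtHeight-child at (∈-children⇒Child c₁∈)) x∈₁
       | Subtree-sound h (AtHeight-child at (∈-children⇒Child c₂∈)) x∈₂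
  ... | C₁ , ch₁ , _ | C₂ , ch₂ , _ = c₁≢c₂ (just-injective (begin
    just c₁             ≡⟨ proj₁ ch₁ ⟨
    head C₁             ≡⟨ cong head (∷-injectiveʳ (paths-unique _ _ (child-chain-path (∈-children⇒Child c₁∈) ch₁)
                                                                      (child-chain-path (∈-children⇒Child c₂∈) ch₂))) ⟩
    head C₂             ≡⟨ proj₁ ch₂ ⟩
    just c₂             ∎))
    where open ≡-Reasoning

  no-clique : ∀ {h v} → AtHeight (suc h) v → ¬ Adjacency.Clique h (suc s) (children v)
  no-clique {h} {v} at (f , f∈ , f-pairs) = no-minor (B , B-nonempty , B-connected , B-disjoint , B-adjacent)
    where
    B : Fin (suc (suc s)) → Fin N → Bool
    B zero    = Subtree zero v
    B (suc i) = Subtree h (f i)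
    f-child : ∀ i → Child T u v (f i)
    f-child i = ∈-children⇒Child (f∈ i)
    f-at : ∀ i → AtHeight h (f i)
    f-at i = AtHeight-child at (f-child i)
    B-nonempty : ∀ i → ∃ λ x → B i x ≡ true
    B-nonempty zero    = v , Subtree-root zero v
    B-nonempty (suc i) = f i , Subtree-root h (f i)
    B-connected : ∀ i → Connected (Induced G (B i))
    B-connected zero    = point-connected v
    B-connected (suc i) = Subtree-connected (f-at i)
    B-overlap-free : ∀ i j → i ≢ j → ∀ x → B i x ≡ true → B j x ≢ true
    B-overlap-free zero    zero    i≢j = ⊥-elim (i≢j refl)
    B-overlap-free zero    (suc j) _   x x∈ x∈′ with Subtree-zero {v} {x} x∈
    ... | refl = Subtree-∌-parent (f-child j) (f-at j) x∈′
    B-overlap-free (suc i) zero    _   x x∈ x∈′ with Subtree-zero {v} {x} x∈′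
    ... | refl = Subtree-∌-parent (f-child i) (f-at i) x∈
    B-overlap-free (suc i) (suc j) i≢j x x∈ x∈′ =
      children-subtrees-disjoint at (f∈ i) (f∈ j) (proj₁ (f-pairs i j (i≢j ∘ cong suc))) x∈ x∈′
    B-disjoint : ∀ i j → i ≢ j → ∀ x → B i x ≡ true → B j x ≡ false
    B-disjoint i j i≢j x x∈ = ¬-not (B-overlap-free i j i≢j x x∈)
    B-adjacent : ∀ i j → i ≢ j → ∃₂ λ x y → B i x ≡ true × B j y ≡ true × adj G x y ≡ true
    B-adjacent zero    zero    i≢j = ⊥-elim (i≢j refl)
    B-adjacent zero    (suc j) _   = v , f j , Subtree-root zero v , Subtree-root h (f j) , E⇒adj (proj₁ (f-child j))
    B-adjacent (suc i) zero    _   = f i , v , Subtree-root h (f i) , Subtree-root zero v , adj-sym (E⇒adj (proj₁ (f-child i)))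
    B-adjacent (suc i) (suc j) i≢j = proj₂ (f-pairs i j (i≢j ∘ cong suc))

  chosen-independent : ∀ {h v} → AtHeight (suc h) v →
                       length (chosen h v) ≡ suc t × AllPairs (λ a b → a ≢ b × ¬ SubtreesAdjacent h a b) (chosen h v)
  chosen-independent {h} {v} at@(Vv , _) =
    proj₂ (proj₂ (Adjacency.select-independent h s t (children v) (children-unique v)))
      (subst (suc s ^ t ≤_) (sym (length-children Vv (AtHeight⇒depth≢ρ at))) Δ-large) (no-clique at)

  Subtree-branch : ∀ h {v x y} → AtHeight h v → Subtree h v x ≡ true → Subtree h v y ≡ true → adj G x y ≡ true →
                   (∃ λ C → ChainIn h v y C × x ∈ C) ⊎ (∃ λ C → ChainIn h v x C × y ∈ C)
  Subtree-branch zero {v} {x} {y} _ x∈ y∈ _ with Subtree-zero {v} {x} x∈ | Subtree-zero {v} {y} y∈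
  ... | refl | refl = inj₁ (v ∷ [] , ((refl , refl , [-]) , Subtree-root zero v ∷ []) , here refl)
  Subtree-branch (suc h) {v} {x} {y} at x∈ y∈ xy with Subtree-cases {h} {v} {x} x∈ | Subtree-cases {h} {v} {y} y∈
  ... | inj₁ refl | _ with Subtree-sound (suc h) at y∈
  ...   | C , ch = inj₁ (C , ch , head-∈ (proj₁ (proj₁ ch)))
  Subtree-branch (suc h) at x∈ y∈ xy | inj₂ _ | inj₁ refl with Subtree-sound (suc h) at x∈
  ...   | C , ch = inj₂ (C , ch , head-∈ (proj₁ (proj₁ ch)))
  Subtree-branch (suc h) {v} {x} {y} at x∈ y∈ xy | inj₂ (c₁ , c₁∈ , x∈₁) | inj₂ (c₂ , c₂∈ , y∈₂) with c₁ ≟ᶠ c₂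
  ... | yes refl = Sum.map extend extend
                     (Subtree-branch h (AtHeight-child at (∈-children⇒Child (chosen⊆children {h} {v} c₁∈))) x∈₁ y∈₂ xy)
    where
    extend : ∀ {z w} → (∃ λ C → ChainIn h c₁ w C × z ∈ C) → ∃ λ C → ChainIn (suc h) v w C × z ∈ C
    extend (C , ch , z∈) = v ∷ C , chainIn-cons at c₁∈ ch , there z∈
  ... | no c₁≢c₂ with AllPairs-either (proj₂ (chosen-independent at)) c₁∈ c₂∈ c₁≢c₂
  ...   | inj₁ (_ , apart) = ⊥-elim (apart (x , y , x∈₁ , y∈₂ , xy))
  ...   | inj₂ (_ , apart) = ⊥-elim (apart (y , x , y∈₂ , x∈₁ , adj-sym xy))

  S : Fin N → Bool
  S = Subtree ρ u

  T′ : SG N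
  T′ = restrict S (E T)

  root-at-height : AtHeight ρ u
  root-at-height = proj₂ rooted , cong (_+ ρ) depth-root

  T′-path : ∀ {x C} → ChainIn ρ u x C → Path T′ u x C
  T′-path ((h , l , sts) , C⊆) = walk-restrict (proj₁ ∘ Step⇒Child) h l C⊆ sts , descending-unique (Linked.map Step⇒Child sts)

  S⇒V : ∀ {x} → S x ≡ true → V T x ≡ true
  S⇒V x∈ with Subtree-sound ρ root-at-height x∈
  ... | C , ch , _ = walk-last-V (proj₁ (descending-path (proj₂ rooted) (proj₁ ch) (proj₁ (proj₂ ch)) (Linked.map Step⇒Child (proj₂ (proj₂ ch)))))

  T′⊑T : T′ ⊑ T
  T′⊑T = (λ _ → S⇒V) , λ a _ e → proj₂ (∧-true⁻ (proj₂ (∧-true⁻ {S a} e)))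

  T′-rooted-subtree : RootedSubtree T u T′ u
  T′-rooted-subtree =
    (λ _ → S⇒V) , (λ _ _ → refl) ,
    (((u , Subtree-root ρ u) , connected , Acyclic-mono T′⊑T acyclic) , Subtree-root ρ u) ,
    λ _ _ _ → Child-mono T′⊑T
    where
    connected : Connected T′
    connected = Walks.connected-from T′ (restrict-sym {B = S} E-sym) u
      λ x x∈ → let (C , ch) = Subtree-sound ρ root-at-height x∈ in C , proj₁ (T′-path ch)

  T′-DistEq : ∀ {v} → S v ≡ true → DistEq T′ u v (depth v)
  T′-DistEq {v} v∈ with Subtree-sound ρ root-at-height v∈
  ... | C , ch = DistEq-mono T′⊑T (depth-DistEq (S⇒V v∈)) (proj₁ (T′-path ch)) (begin
    length C             ≡⟨ +-identityʳ (length C) ⟨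
    length C + 0         ≡⟨ cong (length C +_) depth-root ⟨
    length C + depth u   ≡⟨ chain-length C (proj₁ ch) ⟩
    suc (depth v)        ∎)
    where open ≡-Reasoning

  T′-children : ∀ {v} → S v ≡ true → depth v ≢ ρ → HasChildren T′ u v (suc t)
  T′-children {v} v∈ d≢ρ = chosen h v , proj₁ independent , AllPairs.map proj₁ (proj₂ independent) , λ w → chosen⇒Child , Child⇒chosen
    where
    h = ρ ∸ suc (depth v)
    at : AtHeight (suc h) v
    at = S⇒V v∈ , trans (+-suc (depth v) h) (m+[n∸m]≡n (≤∧≢⇒< (depth≤ρ (S⇒V v∈)) d≢ρ))
    independent = chosen-independent at
    chosen⇒Child : ∀ {w} → w ∈ chosen h v → Child T′ u v w
    chosen⇒Child {w} w∈ with Subtree-sound ρ root-at-height v∈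
    ... | C , (hC , lC , sts) , C⊆ = ∧-true⁺ v∈ (∧-true⁺ w∈S (proj₁ (Step⇒Child w∈))) , C ∷ʳ w , T′-path (chain , All.++⁺ C⊆ (w∈S ∷ [])) , ∈-++⁺ˡ {xs = C} (last-∈ lC)
      where
      chain : Chain u w (C ∷ʳ w)
      chain = head-++ C hC , last-∷ʳ C w , Linked-∷ʳ sts lC w∈
      w∈S : S w ≡ true
      w∈S = Subtree-complete ρ root-at-height chain
    Child⇒chosen : ∀ {w} → Child T′ u v w → w ∈ chosen h v
    Child⇒chosen {w} vw@(e , P , πP , v∈P) with Subtree-sound ρ root-at-height (proj₁ (∧-true⁻ (proj₂ (∧-true⁻ {S v} e))))
    ... | C , ch = Chain⇒Step-into-end C (proj₁ ch) (subst (v ∈_) (paths-unique P C (path-mono T′⊑T πP) (path-mono T′⊑T (T′-path ch))) v∈P)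
                     (sym (Child⇒depth (Child-mono T′⊑T vw)))

  T′-regular : Regular T′ u (suc t) ρ
  T′-regular = (λ v v∈ → depth v , depth≤ρ (S⇒V v∈) , T′-DistEq v∈) ,
               λ v v∈ not-leaf → T′-children v∈ (λ d≡ρ → not-leaf (subst (DistEq T′ u v) d≡ρ (T′-DistEq v∈)))

  T′-branch-induced : BranchInduced G T′ u
  T′-branch-induced x y xy _ x∈ y∈ = Sum.map ancestor ancestor (Subtree-branch ρ root-at-height x∈ y∈ xy)
    where
    ancestor : ∀ {z w} → (∃ λ C → ChainIn ρ u w C × z ∈ C) → Ancestor T′ u z w
    ancestor (C , ch , z∈) = C , T′-path ch , z∈

lemma4p6 : (δ τ ρ : ℕ) → 1 ≤ δ → 1 ≤ τ
    → (G : Graph) → ¬ HasCliqueMinor G (suc τ)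
    → (T : SG (Graph.n G)) → IsSubgraph G T
    → (u : Fin (Graph.n G)) → IsRootedTree T u
    → (Δ : ℕ) → 1 ≤ Δ → τ ^ (δ ∸ 1) ≤ Δ → Regular T u Δ ρ
    → Σ (SG (Graph.n G)) λ T' → RootedSubtree T u T' u × Regular T' u δ ρ × BranchInduced G T' u
lemma4p6 (suc t) (suc s) ρ (s≤s z≤n) (s≤s z≤n) G no-minor T T⊆G u rooted Δ _ Δ-large regular =
  T′ , T′-rooted-subtree , T′-regular , T′-branch-induced
  where open Construction {t = t} G no-minor T T⊆G u rooted Δ-large regular
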